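{- Let $k$ and $r$ be integers with $k \geq 2$ and $r > 0$, let $l = k + r$, and let $S = kl + k - 1$. Suppose the real numbers in $[1,S]$ are colored red and blue so that there is no red solution to $x_1 + x_2 + \cdots + x_k = x_0$ and no blue solution to $x_1 + x_2 + \cdots + x_l = x_0$ (with all variables in $[1,S]$). If $1$ is blue, then $2$ is red.
   Context: A red (resp. blue) solution to an equation means numbers $x_0, x_1, \dots$ in the colored interval satisfying the equation, all colored red (resp. blue); the variables need not be distinct. -}

module Defs where

open import Data.Nat as ℕ using (ℕ; zero; suc)
open import Data.Fin using (Fin; zero; suc)
open import Data.Rational using (ℚ; 0ℚ; 1ℚ; _≤_; _+_)
open import Data.Integer using (+_)
open import Data.Product using (Σ; _×_)
open import Relation.Binary.PropositionalEquality using (_≡_)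
open import Relation.Nullary using (¬_)

data Colour : Set where
  red blue : Colour

toℚ : ℕ → ℚ
toℚ n = Data.Rational._/_ (+ n) 1

sumℚ : (m : ℕ) → (Fin m → ℚ) → ℚ
sumℚ zero    x = 0ℚ
sumℚ (suc m) x = x zero + sumℚ m (λ i → x (suc i))

InI : ℕ → ℚ → Set
InI S x = (1ℚ ≤ x) × (x ≤ toℚ S)

-- a solution of x₁ + ⋯ + xₘ = x₀ with all variables in [1,S] and coloured c
-- (variables need not be distinct)
MonoSolution : (S : ℕ) (χ : ℚ → Colour) (c : Colour) (m : ℕ) → Set
MonoSolution S χ c m =
  Σ ℚ λ x₀ → Σ (Fin m → ℚ) λ x →
    (InI S x₀ × χ x₀ ≡ c) ×
    ((i : Fin m) → InI S (x i) × χ (x i) ≡ c) ×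
    (sumℚ m x ≡ x₀)

{-# OPTIONS --safe #-}
module Submission where

-- Suppose 1 and 2 are both blue. As blue l-term sums, l = 1 + ⋯ + 1 and
-- 2l − 1 = 2 + 1 + ⋯ + 1 are red; hence kl = l + ⋯ + l is blue, and k is red
-- since kl = k + ⋯ + k. As red k-term sums, A = l + (k − 1)k and
-- B = (2l − 1) + (k − 1)k are then blue, yet B = A + 1 + ⋯ + 1 is a blue
-- l-term sum.

open import Defs
open import Data.Nat using (ℕ; suc; _+_; _*_; _∸_; _≤_; _<_; z≤n; s≤s)
import Data.Nat.Properties as ℕₚ
open import Data.Nat.Tactic.RingSolver using (solve-∀)
open import Data.Nat.Coprimality using (1-coprimeTo) renaming (sym to coprime-sym)
open import Data.Integer as ℤ using (+≤+)
import Data.Integer.Properties as ℤₚ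
open import Data.Rational as ℚ using (ℚ; mkℚ; *≤*)
import Data.Rational.Properties as ℚₚ
open import Data.Vec.Functional using (_∷_; replicate)
open import Data.Fin using (Fin; zero; suc)
open import Data.Product using (_×_; _,_)
open import Data.Empty using (⊥-elim)
open import Relation.Binary.PropositionalEquality
  using (_≡_; _≢_; refl; sym; cong; cong₂; subst; subst₂; module ≡-Reasoning)
open import Relation.Nullary using (¬_)

toℚ≡mkℚ : ∀ n → toℚ n ≡ mkℚ (ℤ.+ n) 0 (coprime-sym (1-coprimeTo n))
toℚ≡mkℚ n = ℚₚ.normalize-coprime (coprime-sym (1-coprimeTo n))

toℚ-+ : ∀ m n → toℚ (m + n) ≡ toℚ m ℚ.+ toℚ n
toℚ-+ m n rewrite toℚ≡mkℚ m | toℚ≡mkℚ n =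
  cong (ℚ._/ 1) (sym (cong₂ ℤ._+_ (ℤₚ.*-identityʳ (ℤ.+ m)) (ℤₚ.*-identityʳ (ℤ.+ n))))

toℚ-mono-≤ : ∀ {m n} → m ≤ n → toℚ m ℚ.≤ toℚ n
toℚ-mono-≤ {m} {n} m≤n rewrite toℚ≡mkℚ m | toℚ≡mkℚ n =
  *≤* (subst₂ ℤ._≤_ (sym (ℤₚ.*-identityʳ (ℤ.+ m))) (sym (ℤₚ.*-identityʳ (ℤ.+ n))) (+≤+ m≤n))

sumℚ-replicate-toℚ : ∀ m a → sumℚ m (replicate m (toℚ a)) ≡ toℚ (m * a)
sumℚ-replicate-toℚ 0       a = refl
sumℚ-replicate-toℚ (suc m) a = begin
  toℚ a ℚ.+ sumℚ m (replicate m (toℚ a)) ≡⟨ cong (toℚ a ℚ.+_) (sumℚ-replicate-toℚ m a) ⟩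
  toℚ a ℚ.+ toℚ (m * a)                  ≡⟨ sym (toℚ-+ a (m * a)) ⟩
  toℚ (suc m * a)                         ∎
  where open ≡-Reasoning

toℚ-inI : ∀ {S n} → 1 ≤ n → n ≤ S → InI S (toℚ n)
toℚ-inI 1≤n n≤S = toℚ-mono-≤ 1≤n , toℚ-mono-≤ n≤S

monoSolution-∷replicate : ∀ {S χ c} m b a {x} → 1 ≤ b → 1 ≤ a →
  b + suc m * a ≡ x → x ≤ S →
  χ (toℚ b) ≡ c → χ (toℚ a) ≡ c → χ (toℚ x) ≡ c →
  MonoSolution S χ c (2 + m)
monoSolution-∷replicate {S} {χ} {c} m b a {x} 1≤b 1≤a b+[1+m]a≡x x≤S χb χa χx =
  toℚ x , xs , (toℚ-inI (ℕₚ.≤-trans 1≤b b≤x) x≤S , χx) , xs-valid , sum≡x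
  where
  xs : Fin (2 + m) → ℚ
  xs = toℚ b ∷ replicate (suc m) (toℚ a)

  b≤x : b ≤ x
  b≤x = subst (b ≤_) b+[1+m]a≡x (ℕₚ.m≤m+n b (suc m * a))

  a≤x : a ≤ x
  a≤x = subst (a ≤_) b+[1+m]a≡x (ℕₚ.≤-trans (ℕₚ.m≤m+n a (m * a)) (ℕₚ.m≤n+m (suc m * a) b))

  xs-valid : ∀ i → InI S (xs i) × χ (xs i) ≡ c
  xs-valid zero    = toℚ-inI 1≤b (ℕₚ.≤-trans b≤x x≤S) , χb
  xs-valid (suc i) = toℚ-inI 1≤a (ℕₚ.≤-trans a≤x x≤S) , χa

  sum≡x : sumℚ (2 + m) xs ≡ toℚ x
  sum≡x = begin
    toℚ b ℚ.+ sumℚ (suc m) (replicate (suc m) (toℚ a)) ≡⟨ cong (toℚ b ℚ.+_) (sumℚ-replicate-toℚ (suc m) a) ⟩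
    toℚ b ℚ.+ toℚ (suc m * a)                          ≡⟨ sym (toℚ-+ b (suc m * a)) ⟩
    toℚ (b + suc m * a)                                 ≡⟨ cong toℚ b+[1+m]a≡x ⟩
    toℚ x                                               ∎
    where open ≡-Reasoning

opposite : Colour → Colour
opposite red  = blue
opposite blue = red

≢⇒≡opposite : ∀ {c d} → c ≢ d → c ≡ opposite d
≢⇒≡opposite {red}  {red}  c≢d = ⊥-elim (c≢d refl)
≢⇒≡opposite {red}  {blue} _   = refl
≢⇒≡opposite {blue} {red}  _   = refl
≢⇒≡opposite {blue} {blue} c≢d = ⊥-elim (c≢d refl)

colour-forced : ∀ {S χ c} m b a {x} → ¬ MonoSolution S χ c (2 + m) →
  1 ≤ b → 1 ≤ a → b + suc m * a ≡ x → x ≤ S →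
  χ (toℚ b) ≡ c → χ (toℚ a) ≡ c → χ (toℚ x) ≡ opposite c
colour-forced m b a noSolution 1≤b 1≤a b+[1+m]a≡x x≤S χb χa =
  ≢⇒≡opposite λ χx → noSolution (monoSolution-∷replicate m b a 1≤b 1≤a b+[1+m]a≡x x≤S χb χa χx)

one-blue⇒two-red : ∀ {S} m n (χ : ℚ → Colour) →
  (2 + m) * (2 + n) ≤ S → 1 + (1 + n) * 2 + (1 + m) * (2 + m) ≤ S →
  ¬ MonoSolution S χ red (2 + m) → ¬ MonoSolution S χ blue (2 + n) →
  χ (toℚ 1) ≡ blue → χ (toℚ 2) ≡ red
one-blue⇒two-red {S} m n χ kl≤S B≤S noRed noBlue χ1 = ≢⇒≡opposite two-not-blue
  where
  k l T A B : ℕ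
  k = 2 + m
  l = 2 + n
  T = 1 + suc n * 2
  A = l + suc m * k
  B = T + suc m * k

  l≡1+1+⋯+1 : 1 + suc n * 1 ≡ l
  l≡1+1+⋯+1 = cong (2 +_) (ℕₚ.*-identityʳ n)

  kl≡k+k+⋯+k : k + suc n * k ≡ k * l
  kl≡k+k+⋯+k = ℕₚ.*-comm l k

  B≡A+1+⋯+1 : A + suc n * 1 ≡ B
  B≡A+1+⋯+1 = identity m n
    where
    identity : ∀ m n → 2 + n + suc m * (2 + m) + suc n * 1 ≡ 1 + suc n * 2 + suc m * (2 + m)
    identity = solve-∀

  l≤S : l ≤ S
  l≤S = ℕₚ.≤-trans (ℕₚ.m≤m+n l (suc m * l)) kl≤S

  T≤S : T ≤ S
  T≤S = ℕₚ.≤-trans (ℕₚ.m≤m+n T (suc m * k)) B≤S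

  A≤S : A ≤ S
  A≤S = ℕₚ.≤-trans (subst (A ≤_) B≡A+1+⋯+1 (ℕₚ.m≤m+n A (suc n * 1))) B≤S

  two-not-blue : χ (toℚ 2) ≢ blue
  two-not-blue χ2 = noBlue (monoSolution-∷replicate n A 1 (s≤s z≤n) (s≤s z≤n) B≡A+1+⋯+1 B≤S χA χ1 χB)
    where
    χl : χ (toℚ l) ≡ red
    χl = colour-forced n 1 1 noBlue (s≤s z≤n) (s≤s z≤n) l≡1+1+⋯+1 l≤S χ1 χ1

    χT : χ (toℚ T) ≡ red
    χT = colour-forced n 1 2 noBlue (s≤s z≤n) (s≤s z≤n) refl T≤S χ1 χ2

    χkl : χ (toℚ (k * l)) ≡ blue
    χkl = colour-forced m l l noRed (s≤s z≤n) (s≤s z≤n) refl kl≤S χl χl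

    χk : χ (toℚ k) ≡ red
    χk = ≢⇒≡opposite λ χk≡blue →
      noBlue (monoSolution-∷replicate n k k (s≤s z≤n) (s≤s z≤n) kl≡k+k+⋯+k kl≤S χk≡blue χk≡blue χkl)

    χA : χ (toℚ A) ≡ blue
    χA = colour-forced m l k noRed (s≤s z≤n) (s≤s z≤n) refl A≤S χl χk

    χB : χ (toℚ B) ≡ blue
    χB = colour-forced m T k noRed (s≤s z≤n) (s≤s z≤n) refl B≤S χT χk

lemma4 : (k r : ℕ) → 2 ≤ k → 0 < r →
    (χ : ℚ → Colour) →
    ¬ MonoSolution (k * (k + r) + k ∸ 1) χ red k →
    ¬ MonoSolution (k * (k + r) + k ∸ 1) χ blue (k + r) →
    χ (toℚ 1) ≡ blue →
    χ (toℚ 2) ≡ red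
lemma4 (suc (suc m)) (suc r) (s≤s (s≤s z≤n)) (s≤s z≤n) χ =
  one-blue⇒two-red m (m + suc r) χ kl≤S B≤S
  where
  k l S B : ℕ
  k = 2 + m
  l = k + suc r
  S = k * l + k ∸ 1
  B = 1 + (1 + (m + suc r)) * 2 + (1 + m) * (2 + m)

  S≡kl+[k-1] : S ≡ k * l + suc m
  S≡kl+[k-1] = ℕₚ.+-∸-assoc (k * l) (s≤s z≤n)

  B+[k-2]r≡kl+[k-1] : B + m * suc r ≡ k * l + suc m
  B+[k-2]r≡kl+[k-1] = identity m r
    where
    identity : ∀ m r → 1 + (1 + (m + suc r)) * 2 + (1 + m) * (2 + m) + m * suc r
                     ≡ (2 + m) * (2 + m + suc r) + suc m
    identity = solve-∀

  kl≤S : k * l ≤ S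
  kl≤S = begin
    k * l          ≤⟨ ℕₚ.m≤m+n (k * l) (suc m) ⟩
    k * l + suc m  ≡⟨ sym S≡kl+[k-1] ⟩
    S              ∎
    where open ℕₚ.≤-Reasoning

  B≤S : B ≤ S
  B≤S = begin
    B              ≤⟨ ℕₚ.m≤m+n B (m * suc r) ⟩
    B + m * suc r  ≡⟨ B+[k-2]r≡kl+[k-1] ⟩
    k * l + suc m  ≡⟨ sym S≡kl+[k-1] ⟩
    S              ∎
    where open ℕₚ.≤-Reasoning
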